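{- Let $v$ be a safe degree-$1$ vertex of a tree $T$ with unique neighbor $u$, and let $\bar T$ be the subtree of $T$ obtained by deleting $v$, $u$, and the resulting isolated vertices. Let $I$ be an independent set of $T$ such that $v\in I$ and every token in $I$ is $(T,I)$-movable. Then every token in $I\setminus\{v\}$ is $(\bar T, I\setminus\{v\})$-movable.
   Context: For a graph $G$ and independent sets $I,J$ of $G$, $I\leftrightarrow J$ means there is an edge $\{a,b\}\in E(G)$ with $I\setminus J=\{a\}$ and $J\setminus I=\{b\}$. Write $I\rightsquigarrow_G J$ if there is a sequence $I=I_1,\dots,I_\ell=J$ of independent sets of $G$ (all subsets of $V(G)$) with $I_{i-1}\leftrightarrow I_i$ for all $i$. For a tree $T'$ and an independent set $I$ of $T'$, the token on $y\in I$ is $(T',I)$-rigid if $y\in I'$ for every independent set $I'$ of $T'$ with $I\rightsquigarrow_{T'} I'$, and $(T',I)$-movable otherwise. A degree-$1$ vertex $v$ of a tree $T$ is safe if its unique neighbor $u$ has at most one neighbor of degree more than one. -}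

module Defs where

open import Data.Nat using (ℕ; _<_; _≤_)
open import Data.Bool using (Bool; T)
open import Data.Fin using (Fin)
open import Data.Fin.Subset using (Subset; _∈_; _∉_; _─_; ⁅_⁆; ∣_∣)
open import Data.Vec using (tabulate)
open import Data.List using (List; _∷_; []; _++_; [_]; length)
open import Data.List.Relation.Unary.Linked using (Linked)
open import Data.List.Relation.Unary.Unique.Propositional using (Unique)
open import Data.Product using (Σ; _×_; ∃; ∃-syntax)
open import Data.Unit using (⊤)
open import Data.Empty using (⊥)
open import Relation.Nullary using (¬_)
open import Relation.Binary.PropositionalEquality using (_≡_; _≢_)
open import Relation.Binary.Construct.Closure.ReflexiveTransitive using (Star)

Adjacency : ℕ → Set
Adjacency n = Fin n → Fin n → Bool

module _ {n : ℕ} (adj : Adjacency n) where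

  Edge : Fin n → Fin n → Set
  Edge a b = T (adj a b)

  deg : Fin n → ℕ
  deg x = ∣ tabulate (adj x) ∣

  IsCycle : List (Fin n) → Set
  IsCycle [] = ⊥
  IsCycle (x ∷ xs) = (3 ≤ length (x ∷ xs)) × Unique (x ∷ xs) × Linked Edge ((x ∷ xs) ++ [ x ])

  record IsTree : Set where
    field
      sym     : ∀ a b → Edge a b → Edge b a
      irrefl  : ∀ a → ¬ Edge a a
      connected : ∀ a b → Star Edge a b
      acyclic : ∀ xs → ¬ IsCycle xs

  -- A subgraph is given by a vertex predicate W; its edges are the edges of adj
  -- between vertices of W (induced subgraph).
  module _ (W : Fin n → Set) where

    IsIndependent : Subset n → Set
    IsIndependent I = (∀ x → x ∈ I → W x) × (∀ a b → a ∈ I → b ∈ I → ¬ Edge a b)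

    Slide : Subset n → Subset n → Set
    Slide I J = ∃[ a ] ∃[ b ] (W a × W b × Edge a b × (I ─ J ≡ ⁅ a ⁆) × (J ─ I ≡ ⁅ b ⁆))

    Step : Subset n → Subset n → Set
    Step I J = IsIndependent I × IsIndependent J × Slide I J

    Reach : Subset n → Subset n → Set
    Reach = Star Step

    Rigid : Subset n → Fin n → Set
    Rigid I y = ∀ I' → Reach I I' → y ∈ I'

    Movable : Subset n → Fin n → Set
    Movable I y = ¬ Rigid I y

  AllV : Fin n → Set
  AllV _ = ⊤

  SafeLeaf : Fin n → Fin n → Set
  SafeLeaf v u = deg v ≡ 1 × Edge v u ×
    (∀ a b → Edge u a → Edge u b → 1 < deg a → 1 < deg b → a ≡ b)

  -- vertex set of T̄: delete v, u and the vertices that become isolated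
  TbarV : Fin n → Fin n → Fin n → Set
  TbarV v u w = w ≢ v × w ≢ u × ∃[ x ] (x ≢ v × x ≢ u × Edge w x)

-- Let X = I ∖ {v}.  If a token x ∈ X had no neighbour besides u and v, then x and v would both
-- be adjacent only to u, and each would block the other from ever sliding onto u: v would be
-- rigid.  So every token of X keeps a neighbour in T̄, and X is independent in T̄.
--
-- Movability rests on a fact about forests: if the token on s is rigid and z is a neighbour of
-- s, then z has another rigid neighbour.  Otherwise every other token next to z can be moved
-- off it by moves inside its own branch at z (its component in the forest minus z, a vertex that
-- is never occupied since it is adjacent to s).  The branches are disjoint, so these moves can be
-- replayed one branch after another, after which s slides onto z.  Hence the tokens rigid in T̄,
-- together with v when u is adjacent to one of them, form a set in which every neighbour of a
-- token is adjacent to another token of the set; such tokens never move, in T as well.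
--
-- Movability is a negation, so the whole argument may reason classically inside ¬ ¬.

module Submission where

open import Defs
open import Data.Nat using (ℕ; zero; suc; _≤_; s≤s; z≤n)
open import Data.Nat.Properties using (≤-trans)
open import Data.Bool using (T?)
open import Data.Bool.Properties using (T-≡)
open import Data.Fin using (Fin; zero; suc; _≟_)
open import Data.Fin.Properties using (any?)
open import Data.Fin.Subset using (Subset; _∈_; _∉_; _⊆_; _─_; _-_; _∪_; _∩_; ⁅_⁆; ∣_∣; inside; outside)
open import Data.Fin.Subset.Properties
  using (_∈?_; ⊆-antisym; x∈⁅x⁆; x∈⁅y⁆⇒x≡y; x∈⁅y⁆⇔x≡y; drop-there; ∣⁅x⁆∣≡1; p⊆q⇒∣p∣≤∣q∣;
         x∈p⇒∣p-x∣<∣p∣; x∈p∧x≢y⇒x∈p-y;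
         p─q⊆p; x∈p∧x∉q⇒x∈p─q; x∈p∩q⁺; x∈p∩q⁻; x∈p∪q⁺; x∈p∪q⁻)
open import Data.Vec using ([]; _∷_; here; there; tabulate)
open import Data.Vec.Properties using (lookup⇒[]=; lookup∘tabulate)
open import Data.List using (List; []; _∷_; _++_; [_]; allFin)
open import Data.List.Relation.Unary.All using (All; []; _∷_)
import Data.List.Relation.Unary.All as All
open import Data.List.Relation.Unary.All.Properties using (¬Any⇒All¬)
open import Data.List.Relation.Unary.Any using (here; there)
open import Data.List.Relation.Unary.AllPairs using ([]; _∷_)
open import Data.List.Relation.Unary.Linked using (Linked; []; [-]; _∷_)
import Data.List.Relation.Unary.Linked as Linked
open import Data.List.Relation.Unary.Unique.Propositional using (Unique)
open import Data.List.Membership.Propositional using () renaming (_∈_ to _∈ₗ_)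
open import Data.List.Membership.Propositional.Properties using (∈-allFin)
open import Data.Product using (_×_; _,_; ∃; ∃₂; proj₁; proj₂)
open import Data.Sum using (_⊎_; inj₁; inj₂)
open import Data.Empty using (⊥-elim)
open import Function using (_∘_; const)
open import Function.Bundles using (_⇔_; mk⇔; Equivalence)
import Function.Properties.Equivalence as ⇔
open import Relation.Nullary using (¬_; Dec; yes; no; does; ¬?; _×-dec_)
open import Relation.Nullary.Negation using (¬¬-map; ¬¬-Monad)
open import Relation.Nullary.Decidable using (decidable-stable; ¬¬-excluded-middle)
open import Relation.Binary.PropositionalEquality using (_≡_; _≢_; refl; sym; trans; subst; ≢-sym)
open import Relation.Binary.Construct.Closure.ReflexiveTransitive using (Star; ε; _◅_; _◅◅_; reverse)
open import Effect.Monad using (RawMonad)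
open import Level using (0ℓ)

open Equivalence using (to; from)
open RawMonad (¬¬-Monad {0ℓ}) using (_>>=_; pure)

x∈p─q⇒x∉q : ∀ {n} {x : Fin n} {p q : Subset n} → x ∈ p ─ q → x ∉ q
x∈p─q⇒x∉q {p = _ ∷ _} {outside ∷ _} here ()
x∈p─q⇒x∉q {p = _ ∷ _} {_ ∷ _} (there x∈) (there x∈q) = x∈p─q⇒x∉q x∈ x∈q

module _ {n : ℕ} where

  ∈-extensionality : ∀ {p q : Subset n} → (∀ x → x ∈ p ⇔ x ∈ q) → p ≡ q
  ∈-extensionality p⇔q = ⊆-antisym (to (p⇔q _)) (from (p⇔q _))

  p─q≡⁅x⁆⇒y∈q : ∀ {p q : Subset n} {x y} → p ─ q ≡ ⁅ x ⁆ → y ≢ x → y ∈ p → y ∈ q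
  p─q≡⁅x⁆⇒y∈q {p} {q} {x} {y} eq y≢x y∈p = decidable-stable (y ∈? q) λ y∉q →
    y≢x (x∈⁅y⁆⇒x≡y x (subst (y ∈_) eq (x∈p∧x∉q⇒x∈p─q y∈p y∉q)))

  p─q≡⁅x⁆ : ∀ {p q : Subset n} {x} → x ∈ p → x ∉ q → (∀ {y} → y ≢ x → y ∈ p → y ∈ q) → p ─ q ≡ ⁅ x ⁆
  p─q≡⁅x⁆ {p} {q} {x} x∈p x∉q rest = ⊆-antisym ⊆⁅x⁆ ⁅x⁆⊆
    where
    ⊆⁅x⁆ : p ─ q ⊆ ⁅ x ⁆
    ⊆⁅x⁆ {y} y∈ = from x∈⁅y⁆⇔x≡y (decidable-stable (y ≟ x) λ y≢x →
      x∈p─q⇒x∉q y∈ (rest y≢x (p─q⊆p p q y∈)))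
    ⁅x⁆⊆ : ⁅ x ⁆ ⊆ p ─ q
    ⁅x⁆⊆ y∈ with to x∈⁅y⁆⇔x≡y y∈
    ... | refl = x∈p∧x∉q⇒x∈p─q x∈p x∉q

  x∈p∧y∈p∧x≢y⇒2≤∣p∣ : ∀ {p : Subset n} {x y} → x ∈ p → y ∈ p → x ≢ y → 2 ≤ ∣ p ∣
  x∈p∧y∈p∧x≢y⇒2≤∣p∣ {p} {x} {y} x∈p y∈p x≢y =
    ≤-trans (s≤s (subst (_≤ ∣ p - x ∣) (∣⁅x⁆∣≡1 y) (p⊆q⇒∣p∣≤∣q∣ ⁅y⁆⊆p-x))) (x∈p⇒∣p-x∣<∣p∣ x∈p)
    where
    ⁅y⁆⊆p-x : ⁅ y ⁆ ⊆ p - x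
    ⁅y⁆⊆p-x z∈ with to x∈⁅y⁆⇔x≡y z∈
    ... | refl = x∈p∧x≢y⇒x∈p-y y∈p (≢-sym x≢y)

  splice : Subset n → Subset n → Subset n → Subset n
  splice B J K = (J ∩ B) ∪ (K ─ B)

  ∈-splice-inside : ∀ {B J K : Subset n} {x} → x ∈ B → x ∈ splice B J K ⇔ x ∈ J
  ∈-splice-inside {B} {J} {K} x∈B = mk⇔ into (λ x∈J → x∈p∪q⁺ (inj₁ (x∈p∩q⁺ (x∈J , x∈B))))
    where
    into : _ ∈ splice B J K → _ ∈ J
    into x∈ with x∈p∪q⁻ (J ∩ B) (K ─ B) x∈
    ... | inj₁ x∈J∩B = proj₁ (x∈p∩q⁻ J B x∈J∩B)
    ... | inj₂ x∈K─B = ⊥-elim (x∈p─q⇒x∉q x∈K─B x∈B)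

  ∈-splice-outside : ∀ {B J K : Subset n} {x} → x ∉ B → x ∈ splice B J K ⇔ x ∈ K
  ∈-splice-outside {B} {J} {K} x∉B = mk⇔ into (λ x∈K → x∈p∪q⁺ (inj₂ (x∈p∧x∉q⇒x∈p─q x∈K x∉B)))
    where
    into : _ ∈ splice B J K → _ ∈ K
    into x∈ with x∈p∪q⁻ (J ∩ B) (K ─ B) x∈
    ... | inj₁ x∈J∩B = ⊥-elim (x∉B (proj₂ (x∈p∩q⁻ J B x∈J∩B)))
    ... | inj₂ x∈K─B = p─q⊆p K B x∈K─B

  ∈-splice⁻ : ∀ {B J K : Subset n} {x} → x ∈ splice B J K → (x ∈ B × x ∈ J) ⊎ (x ∉ B × x ∈ K)
  ∈-splice⁻ {B} {x = x} x∈ with x ∈? B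
  ... | yes x∈B = inj₁ (x∈B , to (∈-splice-inside x∈B) x∈)
  ... | no x∉B = inj₂ (x∉B , to (∈-splice-outside x∉B) x∈)

  splice-agree : ∀ {B J J' K : Subset n} {x} → (x ∈ B → x ∈ J ⇔ x ∈ J') →
                 x ∈ splice B J K ⇔ x ∈ splice B J' K
  splice-agree {B} {x = x} J≈J' with x ∈? B
  ... | yes x∈B = ⇔.trans (∈-splice-inside x∈B) (⇔.trans (J≈J' x∈B) (⇔.sym (∈-splice-inside x∈B)))
  ... | no x∉B = ⇔.trans (∈-splice-outside x∉B) (⇔.sym (∈-splice-outside x∉B))

¬¬-comprehension : ∀ {n} (P : Fin n → Set) → ¬ ¬ (∃ λ B → ∀ x → x ∈ B ⇔ P x)
¬¬-comprehension {zero} P = pure ([] , λ ())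
¬¬-comprehension {suc n} P = do
  (B , B⇔P) ← ¬¬-comprehension (P ∘ suc)
  P₀? ← ¬¬-excluded-middle
  pure (does P₀? ∷ B , λ { zero → zero∈⇔ P₀? ; (suc x) → ⇔.trans (mk⇔ drop-there there) (B⇔P x) })
  where
  zero∈⇔ : ∀ {B : Subset n} (P₀? : Dec (P zero)) → zero ∈ does P₀? ∷ B ⇔ P zero
  zero∈⇔ (yes P₀) = mk⇔ (const P₀) (const here)
  zero∈⇔ (no ¬P₀) = mk⇔ (λ ()) (⊥-elim ∘ ¬P₀)

module _ {n : ℕ} (adj : Adjacency n) where

  deg≡1⇒unique-neighbour : ∀ {v a b} → deg adj v ≡ 1 → Edge adj v a → Edge adj v b → a ≡ b
  deg≡1⇒unique-neighbour {v} {a} {b} deg≡1 v~a v~b = decidable-stable (a ≟ b) λ a≢b →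
    2≰1 (subst (2 ≤_) deg≡1 (x∈p∧y∈p∧x≢y⇒2≤∣p∣ (neighbour a v~a) (neighbour b v~b) a≢b))
    where
    neighbour : ∀ x → Edge adj v x → x ∈ tabulate (adj v)
    neighbour x v~x = lookup⇒[]= x _ (trans (lookup∘tabulate (adj v) x) (to T-≡ v~x))
    2≰1 : ¬ 2 ≤ 1
    2≰1 (s≤s ())

record Moves {n : ℕ} (I J : Subset n) (a b : Fin n) : Set where
  field
    a∈I : a ∈ I
    a∉J : a ∉ J
    b∈J : b ∈ J
    b∉I : b ∉ I
    others : ∀ {x} → x ≢ a → x ≢ b → x ∈ I ⇔ x ∈ J

module _ {n : ℕ} {I J : Subset n} {a b : Fin n} where

  slide⇒moves : I ─ J ≡ ⁅ a ⁆ → J ─ I ≡ ⁅ b ⁆ → Moves I J a b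
  slide⇒moves I─J≡a J─I≡b = record
    { a∈I = p─q⊆p I J a∈I─J ; a∉J = x∈p─q⇒x∉q a∈I─J
    ; b∈J = p─q⊆p J I b∈J─I ; b∉I = x∈p─q⇒x∉q b∈J─I
    ; others = λ x≢a x≢b → mk⇔ (p─q≡⁅x⁆⇒y∈q I─J≡a x≢a) (p─q≡⁅x⁆⇒y∈q J─I≡b x≢b)
    }
    where
    a∈I─J = subst (a ∈_) (sym I─J≡a) (x∈⁅x⁆ a)
    b∈J─I = subst (b ∈_) (sym J─I≡b) (x∈⁅x⁆ b)

  moves⇒slide : Moves I J a b → I ─ J ≡ ⁅ a ⁆ × J ─ I ≡ ⁅ b ⁆
  moves⇒slide m =
      p─q≡⁅x⁆ a∈I a∉J (λ x≢a x∈I → to (others x≢a (λ { refl → b∉I x∈I })) x∈I)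
    , p─q≡⁅x⁆ b∈J b∉I (λ x≢b x∈J → from (others (λ { refl → a∉J x∈J }) x≢b) x∈J)
    where open Moves m

module Reconfiguration {n : ℕ} (adj : Adjacency n) (W : Fin n → Set) where

  Independent : Subset n → Set
  Independent = IsIndependent adj W

  step⇒moves : ∀ {I J} → Step adj W I J → ∃₂ λ a b → W a × W b × Edge adj a b × Moves I J a b
  step⇒moves (_ , _ , a , b , Wa , Wb , a~b , I─J≡a , J─I≡b) =
    a , b , Wa , Wb , a~b , slide⇒moves I─J≡a J─I≡b

  moves⇒step : ∀ {I J a b} → Independent I → Independent J → W a → W b → Edge adj a b →
               Moves I J a b → Step adj W I J
  moves⇒step I-ind J-ind Wa Wb a~b m =
    I-ind , J-ind , _ , _ , Wa , Wb , a~b , proj₁ (moves⇒slide m) , proj₂ (moves⇒slide m)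

  reach-independent : ∀ {I J} → Independent I → Reach adj W I J → Independent J
  reach-independent I-ind ε = I-ind
  reach-independent _ ((_ , J-ind , _) ◅ J⇝K) = reach-independent J-ind J⇝K

  movable⇒¬¬vacated : ∀ {I y} → Movable adj W I y → ¬ ¬ (∃ λ J → Reach adj W I J × y ∉ J)
  movable⇒¬¬vacated {y = y} movable never-vacated =
    movable λ J I⇝J → decidable-stable (y ∈? J) λ y∉J → never-vacated (J , I⇝J , y∉J)

  Locked : (Fin n → Set) → Set
  Locked L = ∀ t → L t → ∀ b → W b → Edge adj t b → ¬ ¬ (∃ λ x → L x × x ≢ t × Edge adj b x)

  locked-step : ∀ {L I K} → Locked L → (∀ t → L t → t ∈ I) → Step adj W I K → ∀ t → L t → t ∈ K
  locked-step {L} {I} {K} locked L⊆I I→K t Lt with step⇒moves I→K | I→K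
  ... | a , b , _ , Wb , a~b , m | (_ , (_ , K-edges) , _) =
    decidable-stable (t ∈? K) λ t∉K →
      let t≡a = decidable-stable (t ≟ a) (t∉K ∘ stays t Lt) in
      locked a (subst L t≡a Lt) b Wb a~b λ (x , Lx , x≢a , b~x) → K-edges b x b∈J (stays x Lx x≢a) b~x
    where
    open Moves m
    stays : ∀ x → L x → x ≢ a → x ∈ K
    stays x Lx x≢a = to (others x≢a λ { refl → b∉I (L⊆I x Lx) }) (L⊆I x Lx)

  locked⇒rigid : ∀ {L I y} → Locked L → (∀ t → L t → t ∈ I) → L y → Rigid adj W I y
  locked⇒rigid {L} {I} {y} locked L⊆I Ly J I⇝J = stays I⇝J L⊆I y Ly
    where
    stays : ∀ {I J} → Reach adj W I J → (∀ t → L t → t ∈ I) → ∀ t → L t → t ∈ J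
    stays ε L⊆I = L⊆I
    stays (I→K ◅ K⇝J) L⊆I = stays K⇝J (locked-step locked L⊆I I→K)

module Forest {n : ℕ} (adj : Adjacency n)
  (sym~ : ∀ a b → Edge adj a b → Edge adj b a)
  (irrefl~ : ∀ a → ¬ Edge adj a a)
  (acyclic : ∀ xs → ¬ IsCycle adj xs) where

  open import Data.List.Membership.DecPropositional (_≟_ {n}) using () renaming (_∈?_ to _∈ₗ?_)

  EdgeOff : (Fin n → Set) → Fin n → Fin n → Fin n → Set
  EdgeOff W z a b = W a × W b × a ≢ z × b ≢ z × Edge adj a b

  EdgeOff-sym : ∀ {W z a b} → EdgeOff W z a b → EdgeOff W z b a
  EdgeOff-sym (Wa , Wb , a≢z , b≢z , a~b) = Wb , Wa , b≢z , a≢z , sym~ _ _ a~b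

  Branch : (Fin n → Set) → Fin n → Fin n → Fin n → Set
  Branch W z = Star (EdgeOff W z)

  module _ (z q' : Fin n) (q'~z : Edge adj q' z) (q'≢z : q' ≢ z) where

    EntersVia : Fin n → Fin n → Set
    EntersVia a b = Edge adj a b × (b ≡ z → a ≡ q')

    -- paths a ⋯ q' z that are simple before they reach z
    PathToZ : Fin n → Set
    PathToZ a = ∃ λ ys → Linked EntersVia (a ∷ ys ++ [ z ]) × Unique (a ∷ ys) × All (_≢ z) (a ∷ ys)

    path-suffix : ∀ {a} xs → a ∈ₗ xs →
                  Linked EntersVia (xs ++ [ z ]) → Unique xs → All (_≢ z) xs → PathToZ a
    path-suffix (_ ∷ xs) (here refl) L U A = xs , L , U , A
    path-suffix (_ ∷ xs) (there a∈) L (_ ∷ U) (_ ∷ A) = path-suffix xs a∈ (Linked.tail L) U A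

    loop-erase : ∀ {W a} → Branch W z a q' → PathToZ a
    loop-erase ε = [] , (q'~z , const refl) ∷ [-] , [] ∷ [] , q'≢z ∷ []
    loop-erase {a = a} ((_ , _ , a≢z , b≢z , a~b) ◅ b⇝q') with loop-erase b⇝q'
    ... | ys , L , U , A with a ∈ₗ? _ ∷ ys
    ...   | yes a∈ = path-suffix (_ ∷ ys) a∈ L U A
    ...   | no a∉ = _ ∷ ys , (a~b , ⊥-elim ∘ b≢z) ∷ L , ¬Any⇒All¬ _ a∉ ∷ U , a≢z ∷ A

  neighbour≢ : ∀ {z q} → Edge adj z q → q ≢ z
  neighbour≢ z~q refl = irrefl~ _ z~q

  branches-disjoint : ∀ {W z q q'} → Edge adj z q → Edge adj z q' → q ≢ q' → ¬ Branch W z q q'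
  branches-disjoint {z = z} {q} {q'} z~q z~q' q≢q' q⇝q'
    with loop-erase z q' (sym~ z q' z~q') (neighbour≢ z~q') q⇝q'
  ... | [] , (_ , q≡q') ∷ [-] , _ = q≢q' (q≡q' refl)
  ... | y ∷ ys , L , U , A =
    acyclic (z ∷ q ∷ y ∷ ys) (s≤s (s≤s (s≤s z≤n)) , All.map ≢-sym A ∷ U , z~q ∷ Linked.map proj₁ L)

  module _ (W : Fin n → Set) where
    open Reconfiguration adj W

    module _ {X : Subset n} {z : Fin n} (z-free : ∀ {J} → Reach adj W X J → z ∉ J)
      {B K : Subset n} (B-closed : ∀ {a b} → EdgeOff W z a b → a ∈ B → b ∈ B)
      (K-ind : Independent K) (z∉K : z ∉ K) (K≈X : ∀ {t} → t ∈ B → t ∈ K ⇔ t ∈ X) where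

      private
        ≢z : ∀ {J x} → z ∉ J → x ∈ J → x ≢ z
        ≢z z∉J x∈J refl = z∉J x∈J

      splice-independent : ∀ {J} → Independent J → z ∉ J → Independent (splice B J K)
      splice-independent {J} (J-in-W , J-edges) z∉J = in-W , edges
        where
        in-W : ∀ x → x ∈ splice B J K → W x
        in-W x x∈ with ∈-splice⁻ x∈
        ... | inj₁ (_ , x∈J) = J-in-W x x∈J
        ... | inj₂ (_ , x∈K) = proj₁ K-ind x x∈K
        crossing : ∀ x y → x ∈ B → x ∈ J → y ∉ B → y ∈ K → ¬ Edge adj x y
        crossing x y x∈B x∈J y∉B y∈K x~y =
          y∉B (B-closed (J-in-W x x∈J , proj₁ K-ind y y∈K , ≢z z∉J x∈J , ≢z z∉K y∈K , x~y) x∈B)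
        edges : ∀ a b → a ∈ splice B J K → b ∈ splice B J K → ¬ Edge adj a b
        edges a b a∈ b∈ with ∈-splice⁻ a∈ | ∈-splice⁻ b∈
        ... | inj₁ (_ , a∈J) | inj₁ (_ , b∈J) = J-edges a b a∈J b∈J
        ... | inj₂ (_ , a∈K) | inj₂ (_ , b∈K) = proj₂ K-ind a b a∈K b∈K
        ... | inj₁ (a∈B , a∈J) | inj₂ (b∉B , b∈K) = crossing a b a∈B a∈J b∉B b∈K
        ... | inj₂ (a∉B , a∈K) | inj₁ (b∈B , b∈J) = crossing b a b∈B b∈J a∉B a∈K ∘ sym~ a b

      splice-step : ∀ {J₀ J₁} → Reach adj W X J₀ → Step adj W J₀ J₁ →
                    Reach adj W (splice B J₀ K) (splice B J₁ K)
      splice-step {J₀} {J₁} X⇝J₀ J₀→J₁@(J₀-ind , J₁-ind , _) with step⇒moves J₀→J₁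
      ... | a , b , Wa , Wb , a~b , m = by-side (a ∈? B)
        where
        open Moves m
        X⇝J₁ : Reach adj W X J₁
        X⇝J₁ = X⇝J₀ ◅◅ (J₀→J₁ ◅ ε)
        a-b : EdgeOff W z a b
        a-b = Wa , Wb , ≢z (z-free X⇝J₀) a∈I , ≢z (z-free X⇝J₁) b∈J , a~b
        by-side : Dec (a ∈ B) → Reach adj W (splice B J₀ K) (splice B J₁ K)
        by-side (yes a∈B) =
          moves⇒step (splice-independent J₀-ind (z-free X⇝J₀)) (splice-independent J₁-ind (z-free X⇝J₁))
                     Wa Wb a~b spliced ◅ ε
          where
          b∈B = B-closed a-b a∈B
          spliced : Moves (splice B J₀ K) (splice B J₁ K) a b
          spliced = record
            { a∈I = from (∈-splice-inside a∈B) a∈I ; a∉J = a∉J ∘ to (∈-splice-inside a∈B)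
            ; b∈J = from (∈-splice-inside b∈B) b∈J ; b∉I = b∉I ∘ to (∈-splice-inside b∈B)
            ; others = λ x≢a x≢b → splice-agree (const (others x≢a x≢b))
            }
        by-side (no a∉B) = subst (Reach adj W (splice B J₀ K)) unchanged ε
          where
          b∉B : b ∉ B
          b∉B = a∉B ∘ B-closed (EdgeOff-sym a-b)
          unchanged : splice B J₀ K ≡ splice B J₁ K
          unchanged = ∈-extensionality λ x →
            splice-agree λ x∈B → others (λ { refl → a∉B x∈B }) (λ { refl → b∉B x∈B })

      replay : ∀ {J} → Reach adj W X J → Reach adj W K (splice B J K)
      replay = replay-from ε (subst (Reach adj W K) (sym (∈-extensionality splice-X)) ε)
        where
        splice-X : ∀ x → x ∈ splice B X K ⇔ x ∈ K
        splice-X x with x ∈? B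
        ... | yes x∈B = ⇔.trans (∈-splice-inside x∈B) (⇔.sym (K≈X x∈B))
        ... | no x∉B = ∈-splice-outside x∉B
        replay-from : ∀ {J₀ J} → Reach adj W X J₀ → Reach adj W K (splice B J₀ K) → Reach adj W J₀ J →
                      Reach adj W K (splice B J K)
        replay-from _ K⇝J₀ ε = K⇝J₀
        replay-from X⇝J₀ K⇝J₀ (J₀→J₁ ◅ J₁⇝J) =
          replay-from (X⇝J₀ ◅◅ (J₀→J₁ ◅ ε)) (K⇝J₀ ◅◅ splice-step X⇝J₀ J₀→J₁) J₁⇝J

    vacate : ∀ {I a b} → Independent I → a ∈ I → W b → Edge adj a b →
             (∀ x → x ∈ I → Edge adj b x → x ≡ a) → ∃ λ J → Step adj W I J × a ∉ J
    vacate {I} {a} {b} I-ind@(I-in-W , I-edges) a∈I Wb a~b only-a =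
      (I - a) ∪ ⁅ b ⁆ , moves⇒step I-ind J-ind (I-in-W a a∈I) Wb a~b moves , a∉J
      where
      b∉I : b ∉ I
      b∉I b∈I = I-edges a b a∈I b∈I a~b
      ∈J⁻ : ∀ {x} → x ∈ (I - a) ∪ ⁅ b ⁆ → (x ∈ I × x ≢ a) ⊎ x ≡ b
      ∈J⁻ {x} x∈ with x∈p∪q⁻ (I - a) ⁅ b ⁆ x∈
      ... | inj₁ x∈I-a = inj₁ (p─q⊆p I ⁅ a ⁆ x∈I-a , λ { refl → x∈p─q⇒x∉q x∈I-a (x∈⁅x⁆ a) })
      ... | inj₂ x∈⁅b⁆ = inj₂ (x∈⁅y⁆⇒x≡y b x∈⁅b⁆)
      J-ind : Independent ((I - a) ∪ ⁅ b ⁆)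
      J-ind = in-W , edges
        where
        in-W : ∀ x → x ∈ (I - a) ∪ ⁅ b ⁆ → W x
        in-W x x∈ with ∈J⁻ x∈
        ... | inj₁ (x∈I , _) = I-in-W x x∈I
        ... | inj₂ refl = Wb
        edges : ∀ x y → x ∈ (I - a) ∪ ⁅ b ⁆ → y ∈ (I - a) ∪ ⁅ b ⁆ → ¬ Edge adj x y
        edges x y x∈ y∈ with ∈J⁻ x∈ | ∈J⁻ y∈
        ... | inj₁ (x∈I , _) | inj₁ (y∈I , _) = I-edges x y x∈I y∈I
        ... | inj₂ refl | inj₁ (y∈I , y≢a) = y≢a ∘ only-a y y∈I
        ... | inj₁ (x∈I , x≢a) | inj₂ refl = x≢a ∘ only-a x x∈I ∘ sym~ x b
        ... | inj₂ refl | inj₂ refl = irrefl~ b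
      a∉J : a ∉ (I - a) ∪ ⁅ b ⁆
      a∉J a∈J with ∈J⁻ a∈J
      ... | inj₁ (_ , a≢a) = a≢a refl
      ... | inj₂ refl = b∉I a∈I
      J⊆I : ∀ {x} → x ≢ b → x ∈ (I - a) ∪ ⁅ b ⁆ → x ∈ I
      J⊆I x≢b x∈J with ∈J⁻ x∈J
      ... | inj₁ (x∈I , _) = x∈I
      ... | inj₂ x≡b = ⊥-elim (x≢b x≡b)
      moves : Moves I ((I - a) ∪ ⁅ b ⁆) a b
      moves = record
        { a∈I = a∈I
        ; a∉J = a∉J
        ; b∈J = x∈p∪q⁺ (inj₂ (x∈⁅x⁆ b))
        ; b∉I = b∉I
        ; others = λ x≢a x≢b → mk⇔ (λ x∈I → x∈p∪q⁺ (inj₁ (x∈p∧x≢y⇒x∈p-y x∈I x≢a))) (J⊆I x≢b)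
        }

    module Clearing {X : Subset n} (X-ind : Independent X)
      {s z : Fin n} (s-rigid : Rigid adj W X s) (s~z : Edge adj s z)
      (others-movable : ∀ q → Edge adj z q → q ∈ X → q ≢ s → Movable adj W X q) where

      z-free : ∀ {J} → Reach adj W X J → z ∉ J
      z-free X⇝J z∈J = proj₂ (reach-independent X-ind X⇝J) s z (s-rigid _ X⇝J) z∈J s~z

      OtherToken : Fin n → Set
      OtherToken q = Edge adj z q × q ∈ X × q ≢ s

      record Cleared (ys : List (Fin n)) (K : Subset n) : Set where
        field
          reachable : Reach adj W X K
          vacated : ∀ {q} → q ∈ₗ ys → OtherToken q → q ∉ K
          untouched : ∀ {t} → (∀ {q} → q ∈ₗ ys → OtherToken q → ¬ Branch W z q t) → t ∈ K ⇔ t ∈ X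

      cleared-skip : ∀ {y ys K} → (OtherToken y → y ∉ K) → Cleared ys K → Cleared (y ∷ ys) K
      cleared-skip y-vacant c = record
        { reachable = reachable
        ; vacated = λ { (here refl) → y-vacant ; (there q∈) → vacated q∈ }
        ; untouched = λ outside → untouched (λ q∈ → outside (there q∈))
        }
        where open Cleared c

      cleared-branch : ∀ {y ys K} → OtherToken y → y ∈ K → Cleared ys K → ¬ ¬ ∃ (Cleared (y ∷ ys))
      cleared-branch {y} {ys} {K} y-other@(z~y , y∈X , y≢s) y∈K c = do
        (J , X⇝J , y∉J) ← movable⇒¬¬vacated (others-movable y z~y y∈X y≢s)
        (B , B⇔) ← ¬¬-comprehension (Branch W z y)
        pure (splice B J K , cleared B B⇔ X⇝J y∉J)
        where
        open Cleared c
        apart : ∀ {q t} → q ∈ₗ ys → OtherToken q → Branch W z q t → ¬ Branch W z y t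
        apart q∈ q-other@(z~q , _) q⇝t y⇝t =
          branches-disjoint z~q z~y (λ { refl → vacated q∈ q-other y∈K }) (q⇝t ◅◅ reverse EdgeOff-sym y⇝t)
        cleared : ∀ B → (∀ x → x ∈ B ⇔ Branch W z y x) → ∀ {J} → Reach adj W X J → y ∉ J →
                  Cleared (y ∷ ys) (splice B J K)
        cleared B B⇔ X⇝J y∉J = record
          { reachable =
              reachable ◅◅ replay z-free B-closed (reach-independent X-ind reachable) (z-free reachable) K≈X X⇝J
          ; vacated = λ
              { (here refl) _ → y∉J ∘ to (∈-splice-inside (from (B⇔ y) ε))
              ; (there q∈) q-other →
                  vacated q∈ q-other ∘ to (∈-splice-outside (apart q∈ q-other ε ∘ to (B⇔ _)))
              }
          ; untouched = λ outside →
              ⇔.trans (∈-splice-outside (outside (here refl) y-other ∘ to (B⇔ _)))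
                      (untouched (λ q∈ → outside (there q∈)))
          }
          where
          B-closed : ∀ {a b} → EdgeOff W z a b → a ∈ B → b ∈ B
          B-closed a-b a∈B = from (B⇔ _) (to (B⇔ _) a∈B ◅◅ (a-b ◅ ε))
          K≈X : ∀ {t} → t ∈ B → t ∈ K ⇔ t ∈ X
          K≈X t∈B = untouched λ q∈ q-other q⇝t → apart q∈ q-other q⇝t (to (B⇔ _) t∈B)

      clear : ∀ ys → ¬ ¬ ∃ (Cleared ys)
      clear [] = pure (X , record { reachable = ε ; vacated = λ () ; untouched = const ⇔.refl })
      clear (y ∷ ys) = do
        (K , c) ← clear ys
        y-other? ← ¬¬-excluded-middle
        clear-y y-other? (y ∈? K) c
        where
        clear-y : ∀ {K} → Dec (OtherToken y) → Dec (y ∈ K) → Cleared ys K → ¬ ¬ ∃ (Cleared (y ∷ ys))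
        clear-y (yes y-other) (yes y∈K) c = cleared-branch y-other y∈K c
        clear-y (yes _) (no y∉K) c = pure (_ , cleared-skip (const y∉K) c)
        clear-y (no ¬y-other) _ c = pure (_ , cleared-skip (⊥-elim ∘ ¬y-other) c)

      cleared-all⇒only-s : ∀ {K} → Cleared (allFin n) K → ∀ x → x ∈ K → Edge adj z x → x ≡ s
      cleared-all⇒only-s c x x∈K z~x = decidable-stable (x ≟ s) λ x≢s →
        vacated (∈-allFin x) (z~x , x∈X , x≢s) x∈K
        where
        open Cleared c
        x∈X : x ∈ X
        x∈X = decidable-stable (x ∈? X) λ x∉X → x∉X (to (untouched λ _ (z~q , q∈X , _) q⇝x →
          branches-disjoint z~q z~x (λ { refl → x∉X q∈X }) q⇝x) x∈K)

    rigid⇒¬¬rigid-neighbour : ∀ {X s z} → Independent X → Rigid adj W X s → W z → Edge adj s z →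
                               ¬ ¬ (∃ λ x → Rigid adj W X x × x ≢ s × Edge adj z x)
    rigid⇒¬¬rigid-neighbour {X} {s} {z} X-ind s-rigid Wz s~z none = clear (allFin n) λ (K , c) →
      let open Cleared c
          J , K→J , s∉J = vacate (reach-independent X-ind reachable) (s-rigid K reachable) Wz s~z
                                 (cleared-all⇒only-s c)
      in s∉J (s-rigid J (reachable ◅◅ (K→J ◅ ε)))
      where
      open Clearing X-ind s-rigid s~z (λ q z~q _ q≢s q-rigid → none (q , q-rigid , q≢s , z~q))

module LeafRemoval {n : ℕ} {adj : Adjacency n} (tree : IsTree adj) {v u : Fin n}
  (deg-v : deg adj v ≡ 1) (v~u : Edge adj v u)
  {I : Subset n} (I-ind : IsIndependent adj (AllV adj) I) (v∈I : v ∈ I)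
  (movable : ∀ y → y ∈ I → Movable adj (AllV adj) I y) where

  open IsTree tree renaming (sym to sym~; irrefl to irrefl~)
  open Reconfiguration adj (AllV adj) using (Locked; locked⇒rigid)
  open Forest adj sym~ irrefl~ acyclic using (rigid⇒¬¬rigid-neighbour)

  T̄ : Fin n → Set
  T̄ = TbarV adj v u

  v-neighbour≡u : ∀ {a} → Edge adj v a → a ≡ u
  v-neighbour≡u v~a = deg≡1⇒unique-neighbour adj deg-v v~a v~u

  u∉I : u ∉ I
  u∉I u∈I = proj₂ I-ind v u v∈I u∈I v~u

  ∈I─v⁻ : ∀ {x} → x ∈ I ─ ⁅ v ⁆ → x ∈ I × x ≢ v
  ∈I─v⁻ {x} x∈ = p─q⊆p I ⁅ v ⁆ x∈ , λ { refl → x∈p─q⇒x∉q x∈ (x∈⁅x⁆ v) }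

  has-outer-neighbour : ∀ {x} → x ∈ I → x ≢ v → ∃ λ b → b ≢ v × b ≢ u × Edge adj x b
  has-outer-neighbour {x} x∈I x≢v =
    decidable-stable (any? λ b → ¬? (b ≟ v) ×-dec ¬? (b ≟ u) ×-dec T? (adj x b)) λ none →
      movable v v∈I (locked⇒rigid (pair-locked none) pair⊆I (inj₁ refl))
    where
    x≢u : x ≢ u
    x≢u refl = u∉I x∈I
    Pair : Fin n → Set
    Pair t = t ≡ v ⊎ t ≡ x
    pair⊆I : ∀ t → Pair t → t ∈ I
    pair⊆I t (inj₁ refl) = v∈I
    pair⊆I t (inj₂ refl) = x∈I
    module _ (none : ¬ ∃ λ b → b ≢ v × b ≢ u × Edge adj x b) where
      x-neighbour≡u : ∀ {b} → Edge adj x b → b ≡ u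
      x-neighbour≡u {b} x~b = decidable-stable (b ≟ u) λ b≢u →
        none (b , (λ { refl → x≢u (v-neighbour≡u (sym~ x v x~b)) }) , b≢u , x~b)
      x~u : Edge adj x u
      x~u with connected x v
      ... | ε = ⊥-elim (x≢v refl)
      ... | x~c ◅ _ = subst (Edge adj x) (x-neighbour≡u x~c) x~c
      pair-locked : Locked Pair
      pair-locked t (inj₁ refl) b _ v~b with v-neighbour≡u v~b
      ... | refl = pure (x , inj₂ refl , x≢v , sym~ x u x~u)
      pair-locked t (inj₂ refl) b _ x~b with x-neighbour≡u x~b
      ... | refl = pure (v , inj₁ refl , ≢-sym x≢v , sym~ v u v~u)

  I─v-in-T̄ : ∀ x → x ∈ I ─ ⁅ v ⁆ → T̄ x
  I─v-in-T̄ x x∈ = let x∈I , x≢v = ∈I─v⁻ x∈ in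
    x≢v , (λ { refl → u∉I x∈I }) , has-outer-neighbour x∈I x≢v

  I─v-independent : IsIndependent adj T̄ (I ─ ⁅ v ⁆)
  I─v-independent = I─v-in-T̄ , λ a b a∈ b∈ → proj₂ I-ind a b (proj₁ (∈I─v⁻ a∈)) (proj₁ (∈I─v⁻ b∈))

  RigidInT̄ : Fin n → Set
  RigidInT̄ = Rigid adj T̄ (I ─ ⁅ v ⁆)

  Frozen : Fin n → Set
  Frozen t = RigidInT̄ t ⊎ (t ≡ v × ∃ λ r → RigidInT̄ r × Edge adj u r)

  frozen⊆I : ∀ t → Frozen t → t ∈ I
  frozen⊆I t (inj₁ t-rigid) = proj₁ (∈I─v⁻ (t-rigid _ ε))
  frozen⊆I t (inj₂ (refl , _)) = v∈I

  frozen-locked : Locked Frozen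
  frozen-locked t (inj₁ t-rigid) b _ t~b with b ≟ u
  ... | yes refl = pure (v , inj₂ (refl , t , t-rigid , sym~ t u t~b) , ≢-sym t≢v , sym~ v u v~u)
    where t≢v = proj₂ (∈I─v⁻ (t-rigid _ ε))
  ... | no b≢u = ¬¬-map (λ (x , x-rigid , x≢t , b~x) → x , inj₁ x-rigid , x≢t , b~x)
                        (rigid⇒¬¬rigid-neighbour T̄ I─v-independent t-rigid b∈T̄ t~b)
    where
    t∈T̄ = I─v-in-T̄ t (t-rigid _ ε)
    b∈T̄ : T̄ b
    b∈T̄ = (λ { refl → proj₁ (proj₂ t∈T̄) (v-neighbour≡u (sym~ t v t~b)) }) , b≢u
        , t , proj₁ t∈T̄ , proj₁ (proj₂ t∈T̄) , sym~ t b t~b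
  frozen-locked t (inj₂ (refl , r , r-rigid , u~r)) b _ v~b with v-neighbour≡u v~b
  ... | refl = pure (r , inj₁ r-rigid , proj₂ (∈I─v⁻ (r-rigid _ ε)) , u~r)

  I─v-movable : ∀ y → y ∈ I ─ ⁅ v ⁆ → Movable adj T̄ (I ─ ⁅ v ⁆) y
  I─v-movable y y∈ y-rigid =
    movable y (proj₁ (∈I─v⁻ y∈)) (locked⇒rigid frozen-locked frozen⊆I (inj₁ y-rigid))

lemma9 : {n : ℕ} (adj : Adjacency n) → IsTree adj →
    (v u : Fin n) → SafeLeaf adj v u →
    (I : Subset n) → IsIndependent adj (AllV adj) I → v ∈ I →
    (∀ y → y ∈ I → Movable adj (AllV adj) I y) →
    IsIndependent adj (TbarV adj v u) (I ─ ⁅ v ⁆) ×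
    (∀ y → y ∈ I ─ ⁅ v ⁆ → Movable adj (TbarV adj v u) (I ─ ⁅ v ⁆) y)
lemma9 adj tree v u (deg-v , v~u , _) I I-ind v∈I movable = I─v-independent , I─v-movable
  where open LeafRemoval tree deg-v v~u I-ind v∈I movable
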